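{- Let $P$ be a finite bounded poset with $|P|>1$, and let $\omega$ be an admissible map on $P$ such that for all $a',a''\in P$: $\omega(\{a'\}\wedge_{\vartriangle}\{a''\})=\omega(a')$ if and only if $a'\le a''$. Let $r$ be a rational with $0\le r<1$, let $A$ be a nontrivial antichain in $P$, and let $k\in[1,\omega(P)]$. Suppose that $\bigl|\bigcap_{a\in A}\mathfrak I(a)-\{\hat0_P\}\bigr|=0$. If $k\notin\mathcal D_r(P,A;\omega)$, then $|\mathbf I_{r,k}(P,A;\omega)|=0$.
   Context: $P$ is a finite poset with least element $\hat0_P$ and greatest element $\hat1_P$. For $A\subseteq P$, $\mathfrak I(A)=\{p: p\le a\text{ for some }a\in A\}$, $\mathfrak I(a):=\mathfrak I(\{a\})$; $\max Q$, $\min Q$ are the maximal/minimal elements of $Q$. $\mathfrak{A}_{\vartriangle}(P)$: all antichains (including empty) ordered by $\mathfrak I(A')\subseteq\mathfrak I(A'')$, meet $A'\wedge_{\vartriangle}A''=\max(\mathfrak I(A')\cap\mathfrak I(A''))$. The trivial antichains are $\emptyset$ and $\{\hat0_P\}$. Admissible map: $\omega:\mathfrak{A}_{\vartriangle}(P)\to\{ -1\}\cup\mathbb N$ with $\omega(\emptyset)=-1$, $\omega(\{\hat0_P\})=0$, $0<\omega(A')\le\omega(A'')$ whenever $\{\hat0_P\}<A'\le A''$ in $\mathfrak{A}_{\vartriangle}(P)$; $\omega(b):=\omega(\{b\})$, $\omega(P):=\omega(\{\hat1_P\})$. $\mathbf I_{r,k}(P,A;\omega)$ is the set of $b\in P\setminus\{\hat0_P\}$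 with $\omega(b)=k$ and $\omega(\{b\}\wedge_{\vartriangle}\{a\})/\omega(b)>r$ for all $a\in A$. For $a\in P\setminus\{\hat0_P\}$, $\mathcal F(P,a;\omega)$ is the ascending sequence consisting of $\tfrac01,\tfrac11$ and the reduced forms of the fractions $\omega(\{b\}\wedge_{\vartriangle}\{a\})/\omega(b)$, $b\in P\setminus\{\hat0_P\}$; $\mathfrak f_{P,a;\omega}(r):=\max\{f\in\mathcal F(P,a;\omega): f\le r\}$. For a fraction $f$ in lowest terms, $\underline f$ is its numerator and $\overline f$ its denominator. Define $$\mathcal D_r(P,A;\omega):=\bigcap_{a\in A}\Biggl(\bigcup_{f\in\mathcal F(P,a;\omega):\ \mathfrak f_{P,a;\omega}(r)<f<\frac11}\Bigl\{s\overline f:\ 1\le s\le\min\{\lfloor\omega(a)/\underline f\rfloor,\lfloor\omega(P)/\overline f\rfloor\}\Bigr\}\ \cup\ \{\omega(e): e\in\mathfrak I(a)-\{\hat0_P\}\}\Biggr).$$ $[1,j]=\{1,\dots,j\}$. -}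

module Defs where

open import Level using (0ℓ)
open import Data.Nat as ℕ using (ℕ; zero; suc)
open import Data.Integer as ℤ using (ℤ; +_; -[1+_]; +[1+_])
open import Data.Rational as ℚ using (ℚ; 0ℚ; 1ℚ; _⊔_; ↥_; ↧ₙ_) renaming (floor to floorℚ)
open import Data.Rational.Properties as ℚP using ()
open import Data.Fin as Fin using (Fin)
open import Data.Fin.Properties as FinP using ()
open import Data.Fin.Subset as Sub using (Subset; ⁅_⁆; _∈_)
open import Data.Vec as Vec using (tabulate; lookup)
open import Data.List as List using (List; _∷_; []; allFin; filter; map)
open import Data.Bool.ListAction using (any)
open import Data.List.Membership.Propositional as LM using ()
open import Data.Bool using (Bool; true; false; _∧_; not; T)
open import Data.Product using (Σ; ∃; _×_; _,_)
open import Data.Sum using (_⊎_)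
open import Relation.Binary using (Rel; Decidable)
open import Relation.Binary.PropositionalEquality using (_≡_; _≢_)
open import Relation.Nullary using (¬_; does)
open import Relation.Nullary.Decidable using (⌊_⌋; ¬?)

record FinBoundedPoset : Set₁ where
  field
    n       : ℕ
    _≤_     : Rel (Fin n) 0ℓ
    _≤?_    : Decidable _≤_
    ≤-refl  : ∀ x → x ≤ x
    ≤-antisym : ∀ {x y} → x ≤ y → y ≤ x → x ≡ y
    ≤-trans : ∀ {x y z} → x ≤ y → y ≤ z → x ≤ z
    0̂       : Fin n
    1̂       : Fin n
    0̂-least : ∀ x → 0̂ ≤ x
    1̂-greatest : ∀ x → x ≤ 1̂

module _ (P : FinBoundedPoset) where
  open FinBoundedPoset P

  IsAntichain : Subset n → Set
  IsAntichain A = ∀ x y → x ∈ A → y ∈ A → x ≤ y → x ≡ y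

  InIdeal : Subset n → Fin n → Set
  InIdeal A p = ∃ λ a → a ∈ A × p ≤ a

  _⊑_ : Subset n → Subset n → Set
  A' ⊑ A'' = ∀ p → InIdeal A' p → InIdeal A'' p

  _⊏_ : Subset n → Subset n → Set
  A' ⊏ A'' = A' ⊑ A'' × A' ≢ A''

  leqᵇ : Fin n → Fin n → Bool
  leqᵇ x y = does (x ≤? y)

  inIdealᵇ : Subset n → Fin n → Bool
  inIdealᵇ A p = any (λ a → lookup A a ∧ leqᵇ p a) (allFin n)

  eqᵇ : Fin n → Fin n → Bool
  eqᵇ x y = does (x Fin.≟ y)

  maxOf : (Fin n → Bool) → Subset n
  maxOf S = tabulate λ p →
    S p ∧ not (any (λ q → S q ∧ leqᵇ p q ∧ not (eqᵇ p q)) (allFin n))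

  _∧Δ_ : Subset n → Subset n → Subset n
  A' ∧Δ A'' = maxOf (λ p → inIdealᵇ A' p ∧ inIdealᵇ A'' p)

  -- Admissible map ω : 𝔄_Δ(P) → {-1} ∪ ℕ, modelled as a map on all subsets
  -- into ℤ whose values on antichains are constrained.
  Admissible : (Subset n → ℤ) → Set
  Admissible ω =
    ω Sub.⊥ ≡ -[1+ 0 ] ×
    ω ⁅ 0̂ ⁆ ≡ + 0 ×
    (∀ A' A'' → IsAntichain A' → IsAntichain A'' →
       ⁅ 0̂ ⁆ ⊏ A' → A' ⊑ A'' → (+ 0 ℤ.< ω A') × (ω A' ℤ.≤ ω A''))

  -- the fraction p/q as a reduced rational (q > 0 in all uses; 0 otherwise)
  frac : ℤ → ℤ → ℚ
  frac p (+[1+ q ]) = p ℚ./ suc q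
  frac p _          = 0ℚ

  module _ (ω : Subset n → ℤ) where

    ω₁ : Fin n → ℤ
    ω₁ b = ω ⁅ b ⁆

    ωP : ℤ
    ωP = ω ⁅ 1̂ ⁆

    ratio : Fin n → Fin n → ℚ
    ratio b a = frac (ω (⁅ b ⁆ ∧Δ ⁅ a ⁆)) (ω₁ b)

    InI : ℚ → Subset n → ℕ → Fin n → Set
    InI r A k b = b ≢ 0̂ × ω₁ b ≡ + k × (∀ a → a ∈ A → r ℚ.< ratio b a)

    -- ℱ(P,a;ω) as a list (order/duplicates irrelevant to its use)
    𝓕 : Fin n → List ℚ
    𝓕 a = 0ℚ ∷ 1ℚ ∷ map (λ b → ratio b a) (filter (λ b → ¬? (b Fin.≟ 0̂)) (allFin n))

    -- 𝔣_{P,a;ω}(r) = max { f ∈ ℱ : f ≤ r }  (for r ≥ 0, 0/1 is among them)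
    𝔣 : Fin n → ℚ → ℚ
    𝔣 a r = List.foldr _⊔_ 0ℚ (filter (ℚP._≤? r) (𝓕 a))

    InD : ℚ → Subset n → ℕ → Set
    InD r A k = ∀ a → a ∈ A →
      (Σ ℚ λ f → f LM.∈ 𝓕 a × 𝔣 a r ℚ.< f × f ℚ.< 1ℚ ×
         Σ ℕ λ s → 1 ℕ.≤ s ×
           (+ s ℤ.≤ (floorℚ (frac (ω₁ a) (↥ f)) ℤ.⊓ floorℚ (frac ωP (+ (↧ₙ f))))) ×
           k ≡ s ℕ.* ↧ₙ f)
      ⊎ (Σ (Fin n) λ e → e ≤ a × e ≢ 0̂ × ω₁ e ≡ + k)

-- Let b ∈ 𝐈_{r,k}(P,A;ω); we show k ∈ 𝒟_r(P,A;ω), one a ∈ A at a time. If b ≤ a, then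
-- e = b is an element of 𝔍(a) − {0̂} with ω(e) = k. Otherwise let c = ω({b} ∧ {a}). Since
-- c/k > r ≥ 0 the meet is not {0̂}, so admissibility gives 0 < c ≤ ω(a) and c ≤ ω(b) = k,
-- and c ≠ k because b ≰ a. Hence f = c/k ∈ ℱ(P,a;ω) satisfies 𝔣(r) ≤ r < f < 1. With
-- g = gcd(c,k) we have g·f̲ = c ≤ ω(a) and g·f̄ = k ≤ ω(P), so k = g·f̄ is one of the
-- multiples s·f̄ allowed in 𝒟_r.

module Submission where

open import Defs
open import Data.Nat as ℕ using (ℕ)
open import Data.Integer as ℤ using (+_)
open import Data.Rational as ℚ using (ℚ; 0ℚ; 1ℚ)
open import Data.Fin using (Fin)
import Data.Fin as Fin
open import Data.Fin.Subset as Sub using (Subset; ⁅_⁆; _∈_)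
open import Data.Product using (_×_)
open import Relation.Binary.PropositionalEquality using (_≡_; _≢_)
open import Relation.Nullary using (¬_)
open import Function.Bundles using (_⇔_)

open import Data.Bool using (Bool; true; false; T; not; _∧_)
open import Data.Bool.ListAction using (any)
open import Data.Bool.Properties using (T-≡; T-∧)
open import Data.Fin.Induction using (po-noetherian)
open import Data.Fin.Subset.Properties using (x∈⁅x⁆; x∈⁅y⁆⇒x≡y)
open import Data.Integer using (ℤ; +[1+_]; -[1+_]; +≤+; +<+)
import Data.Integer.Properties as ℤP
open import Data.Integer.DivMod using (div-pos-is-/ℕ)
open import Data.List using (allFin)
open import Data.List.Properties using (foldr-preservesᵇ)
import Data.List.Membership.Propositional as List
open import Data.List.Membership.Propositional using (lose)
open import Data.List.Membership.Propositional.Properties using (∈-allFin; ∈-map⁺; ∈-filter⁺)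
open import Data.List.Relation.Unary.All.Properties using (all-filter)
open import Data.List.Relation.Unary.Any using (there; satisfied)
open import Data.List.Relation.Unary.Any.Properties using (any⁺; any⁻)
open import Data.Nat using (zero; suc; NonZero; _/_; _*_)
import Data.Nat.Properties as ℕP
open import Data.Nat.Coprimality using (Coprime; coprime-/gcd)
open import Data.Nat.DivMod using (m*n/n≡m; /-monoˡ-≤; m*[n/m]≡n; m*n/m*o≡n/o; /-congˡ; /-congʳ)
open import Data.Nat.GCD using (gcd; gcd[m,n]∣m; gcd[m,n]∣n; gcd[m,n]≢0; m/gcd[m,n]≢0; n/gcd[m,n]≢0)
open import Data.Product using (Σ; ∃; _,_; proj₁; proj₂)
open import Data.Product.Function.NonDependent.Propositional using (_×-⇔_)
open import Data.Rational using (mkℚ+; ↥_; ↧ₙ_; *<*) renaming (floor to ⌊_⌋)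
import Data.Rational.Properties as ℚP
open import Data.Sum using (inj₁; inj₂)
open import Data.Unit using (tt)
open import Data.Vec using (lookup; tabulate)
open import Data.Vec.Properties using (lookup⇒[]=; []=⇒lookup; lookup∘tabulate)
open import Function using (_∘_; const; id; flip)
open import Function.Bundles using (Equivalence; mk⇔)
import Function.Properties.Equivalence as ⇔
open import Function.Related.TypeIsomorphisms using (¬-cong-⇔)
open import Induction.WellFounded using (Acc; acc)
open import Relation.Binary.PropositionalEquality
  using (refl; sym; trans; cong; subst; subst₂; module ≡-Reasoning)
open import Relation.Binary.PropositionalEquality.Properties using (isEquivalence)
open import Relation.Binary.Structures using (IsPartialOrder)
open import Relation.Nullary using (Dec; yes; no; does)
open import Relation.Nullary.Decidable using (decidable-stable; T?; ¬?)

open Equivalence using (to; from)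

floor-mkℚ+ : ∀ m n .{{_ : NonZero n}} .(c : Coprime m n) → ⌊ mkℚ+ m n c ⌋ ≡ + (m / n)
floor-mkℚ+ m (suc n) c = div-pos-is-/ℕ (+ m) (suc n)

module GcdNonZero (m n : ℕ) .{{_ : NonZero n}} where
  instance
    gcd≢0 : NonZero (gcd m n)
    gcd≢0 = ℕ.≢-nonZero (gcd[m,n]≢0 m n (inj₂ (ℕ.≢-nonZero⁻¹ n)))

    n/gcd≢0 : NonZero (n / gcd m n)
    n/gcd≢0 = ℕ.≢-nonZero (n/gcd[m,n]≢0 m n)

module _ (m n : ℕ) .{{_ : NonZero n}} where
  open GcdNonZero m n

  ↥-+/ : ↥ (+ m ℚ./ n) ≡ + (m / gcd m n)
  ↥-+/ = ℚP.↥-mkℚ+ (m / gcd m n) (n / gcd m n)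

  ↧ₙ-+/ : ↧ₙ (+ m ℚ./ n) ≡ n / gcd m n
  ↧ₙ-+/ = ℤP.+-injective (ℚP.↧-mkℚ+ (m / gcd m n) (n / gcd m n))

  floor-+/ : ⌊ + m ℚ./ n ⌋ ≡ + (m / n)
  floor-+/ = begin
    ⌊ + m ℚ./ n ⌋                   ≡⟨ floor-mkℚ+ (m / g) (n / g) (coprime-/gcd m n) ⟩
    + ((m / g) / (n / g))           ≡⟨ cong +_ (sym (m*n/m*o≡n/o g (m / g) (n / g))) ⟩
    + (g * (m / g) / (g * (n / g))) ≡⟨ cong +_ (trans (/-congˡ (m*[n/m]≡n (gcd[m,n]∣m m n)))
                                                      (/-congʳ (m*[n/m]≡n (gcd[m,n]∣n m n)))) ⟩
    + (m / n)                       ∎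
    where
    open ≡-Reasoning
    g : ℕ
    g = gcd m n
    instance
      g*[n/g]≢0 : NonZero (g * (n / g))
      g*[n/g]≢0 = ℕP.m*n≢0 g (n / g)

≤-floor-+/ : ∀ {s m n} .{{_ : NonZero n}} → s * n ℕ.≤ m → + s ℤ.≤ ⌊ + m ℚ./ n ⌋
≤-floor-+/ {s} {m} {n} sn≤m = subst (+ s ℤ.≤_) (sym (floor-+/ m n))
  (+≤+ (subst (ℕ._≤ m / n) (m*n/n≡m s n) (/-monoˡ-≤ n sn≤m)))

+/<1 : ∀ {m n} .{{_ : NonZero n}} → m ℕ.< n → + m ℚ./ n ℚ.< 1ℚ
+/<1 {m} {n} m<n = *<* (begin-strict
  ↥ f ℤ.* + 1  ≡⟨ ℤP.*-identityʳ (↥ f) ⟩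
  ↥ f          <⟨ ℤP.*-cancelʳ-<-nonNeg (+ gcd m n) ↥f*g<↧f*g ⟩
  + ↧ₙ f       ≡⟨ sym (ℤP.*-identityˡ (+ ↧ₙ f)) ⟩
  + 1 ℤ.* + ↧ₙ f ∎)
  where
  open ℤP.≤-Reasoning
  f : ℚ
  f = + m ℚ./ n
  ↥f*g<↧f*g : ↥ f ℤ.* + gcd m n ℤ.< + ↧ₙ f ℤ.* + gcd m n
  ↥f*g<↧f*g = subst₂ ℤ._<_ (sym (ℚP.↥-/ (+ m) n)) (sym (ℚP.↧-/ (+ m) n)) (+<+ m<n)

T-does : ∀ {a} {A : Set a} (a? : Dec A) → T (does a?) ⇔ A
T-does (yes a) = mk⇔ (const a) (const tt)
T-does (no ¬a) = mk⇔ (λ ()) ¬a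

T-lookup∘tabulate : ∀ {n} (f : Fin n → Bool) {x} → T (lookup (tabulate f) x) ⇔ T (f x)
T-lookup∘tabulate f {x} = mk⇔ (subst T (lookup∘tabulate f x)) (subst T (sym (lookup∘tabulate f x)))

T-not : ∀ {b} → T (not b) ⇔ (¬ T b)
T-not {true}  = mk⇔ (λ ()) (λ ¬t → ¬t tt)
T-not {false} = mk⇔ (const id) (const tt)

module _ (P : FinBoundedPoset) where
  open FinBoundedPoset P

  T-leqᵇ : ∀ {x y} → T (leqᵇ P x y) ⇔ x ≤ y
  T-leqᵇ {x} {y} = T-does (x ≤? y)

  T-eqᵇ : ∀ {x y} → T (eqᵇ P x y) ⇔ x ≡ y
  T-eqᵇ {x} {y} = T-does (x Fin.≟ y)

  T-lookup : ∀ {A : Subset n} {x} → T (lookup A x) ⇔ x ∈ A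
  T-lookup {A} {x} = mk⇔ (lookup⇒[]= x A ∘ to T-≡) (from T-≡ ∘ []=⇒lookup)

  T-any-allFin : ∀ {p : Fin n → Bool} → T (any p (allFin n)) ⇔ ∃ (T ∘ p)
  T-any-allFin {p} = mk⇔
    (satisfied ∘ any⁻ p (allFin n))
    (λ (x , px) → any⁺ p (lose (∈-allFin x) px))

  T-inIdealᵇ : ∀ {A p} → T (inIdealᵇ P A p) ⇔ InIdeal P A p
  T-inIdealᵇ {A} {p} = mk⇔
    (λ t → let (a , a∈A∧p≤a) = to T-any-allFin t ; (a∈A , p≤a) = to T-∧ a∈A∧p≤a
           in a , to T-lookup a∈A , to T-leqᵇ p≤a)
    (λ (a , a∈A , p≤a) → from T-any-allFin (a , from T-∧ (from T-lookup a∈A , from T-leqᵇ p≤a)))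

  ≤-isPartialOrder : IsPartialOrder _≡_ _≤_
  ≤-isPartialOrder = record
    { isPreorder = record
      { isEquivalence = isEquivalence
      ; reflexive     = λ { refl → ≤-refl _ }
      ; trans         = ≤-trans
      }
    ; antisym = ≤-antisym
    }

  _<_ : Fin n → Fin n → Set
  x < y = x ≤ y × x ≢ y

  hasStrictUpperBoundᵇ : (Fin n → Bool) → Fin n → Bool
  hasStrictUpperBoundᵇ S p = any (λ q → S q ∧ leqᵇ P p q ∧ not (eqᵇ P p q)) (allFin n)

  module _ {S : Fin n → Bool} where

    T-hasStrictUpperBoundᵇ : ∀ {p} → T (hasStrictUpperBoundᵇ S p) ⇔ ∃ λ q → T (S q) × p < q
    T-hasStrictUpperBoundᵇ {p} = mk⇔
      (λ t → let (q , tq) = to T-any-allFin t ; (Sq , t′) = to T-∧ tq ; (p≤q , p≢q) = to T-∧ t′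
             in q , Sq , to T-leqᵇ p≤q , to T-not p≢q ∘ from T-eqᵇ)
      (λ (q , Sq , p≤q , p≢q) → from T-any-allFin
        (q , from T-∧ (Sq , from T-∧ (from T-leqᵇ p≤q , from T-not (p≢q ∘ to T-eqᵇ)))))

    ∈-maxOf : ∀ {x} → x ∈ maxOf P S ⇔ (T (S x) × ¬ (∃ λ q → T (S q) × x < q))
    ∈-maxOf {x} =
      ⇔.trans (⇔.sym T-lookup)
      (⇔.trans (T-lookup∘tabulate (λ p → S p ∧ not (hasStrictUpperBoundᵇ S p)))
      (⇔.trans T-∧
               (⇔.refl ×-⇔ ⇔.trans T-not (¬-cong-⇔ T-hasStrictUpperBoundᵇ))))

    maxOf-antichain : IsAntichain P (maxOf P S)
    maxOf-antichain x y x∈ y∈ x≤y = decidable-stable (x Fin.≟ y) λ x≢y →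
      proj₂ (to ∈-maxOf x∈) (y , proj₁ (to ∈-maxOf y∈) , x≤y , x≢y)

    maxOf-upperBound : ∀ {p} → T (S p) → ∃ λ q → q ∈ maxOf P S × p ≤ q
    maxOf-upperBound {p} = go p (po-noetherian ≤-isPartialOrder p)
      where
      go : ∀ p → Acc (flip _<_) p → T (S p) → ∃ λ q → q ∈ maxOf P S × p ≤ q
      go p (acc rec) Sp with T? (hasStrictUpperBoundᵇ S p)
      ... | no ¬above = p , from ∈-maxOf (Sp , ¬above ∘ from T-hasStrictUpperBoundᵇ) , ≤-refl p
      ... | yes above with to T-hasStrictUpperBoundᵇ above
      ...   | q , Sq , p<q with go q (rec p<q) Sq
      ...     | q′ , q′∈ , q≤q′ = q′ , q′∈ , ≤-trans (proj₁ p<q) q≤q′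

  InIdeal-⁅⁆ : ∀ {x p} → InIdeal P ⁅ x ⁆ p ⇔ p ≤ x
  InIdeal-⁅⁆ {x} = mk⇔
    (λ (y , y∈⁅x⁆ , p≤y) → subst (_ ≤_) (x∈⁅y⁆⇒x≡y x y∈⁅x⁆) p≤y)
    (λ p≤x → x , x∈⁅x⁆ x , p≤x)

  InIdeal-downClosed : ∀ {A p q} → p ≤ q → InIdeal P A q → InIdeal P A p
  InIdeal-downClosed p≤q (a , a∈A , q≤a) = a , a∈A , ≤-trans p≤q q≤a

  ⁅⁆-⊑ : ∀ {A x} → InIdeal P A x → _⊑_ P ⁅ x ⁆ A
  ⁅⁆-⊑ x∈𝔍A p p∈𝔍x = InIdeal-downClosed (to InIdeal-⁅⁆ p∈𝔍x) x∈𝔍A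

  ⁅⁆-antichain : ∀ x → IsAntichain P ⁅ x ⁆
  ⁅⁆-antichain x y z y∈ z∈ _ = trans (x∈⁅y⁆⇒x≡y x y∈) (sym (x∈⁅y⁆⇒x≡y x z∈))

  InIdeal-∧Δ : ∀ {A′ A″ p} → InIdeal P (_∧Δ_ P A′ A″) p ⇔ (InIdeal P A′ p × InIdeal P A″ p)
  InIdeal-∧Δ {A′} {A″} = mk⇔
    (λ (q , q∈ , p≤q) → let (q∈𝔍A′ , q∈𝔍A″) = to T-∧ (proj₁ (to ∈-maxOf q∈))
                       in InIdeal-downClosed p≤q (to T-inIdealᵇ q∈𝔍A′) ,
                          InIdeal-downClosed p≤q (to T-inIdealᵇ q∈𝔍A″))
    (λ (p∈𝔍A′ , p∈𝔍A″) →
      maxOf-upperBound (from T-∧ (from T-inIdealᵇ p∈𝔍A′ , from T-inIdealᵇ p∈𝔍A″)))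

  ∧Δ-⊑ˡ : ∀ A′ A″ → _⊑_ P (_∧Δ_ P A′ A″) A′
  ∧Δ-⊑ˡ A′ A″ _ = proj₁ ∘ to (InIdeal-∧Δ {A′} {A″})

  ∧Δ-⊑ʳ : ∀ A′ A″ → _⊑_ P (_∧Δ_ P A′ A″) A″
  ∧Δ-⊑ʳ A′ A″ _ = proj₂ ∘ to (InIdeal-∧Δ {A′} {A″})

  frac-0 : ∀ d → frac P (+ 0) d ≡ 0ℚ
  frac-0 (+ zero)   = refl
  frac-0 +[1+ d ]   = ℚP.0/n≡0 (suc d)
  frac-0 -[1+ d ]   = refl

  ≤-floor-frac : ∀ {s d x} .{{_ : NonZero d}} → + (s * d) ℤ.≤ x → + s ℤ.≤ ⌊ frac P x (+ d) ⌋
  ≤-floor-frac {d = suc d} (+≤+ sd≤x) = ≤-floor-+/ sd≤x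

  BoundedMultipleOfDenominator : ℤ → ℤ → ℚ → ℕ → Set
  BoundedMultipleOfDenominator wa wP f k =
    Σ ℕ λ s → 1 ℕ.≤ s × (+ s ℤ.≤ (⌊ frac P wa (↥ f) ⌋ ℤ.⊓ ⌊ frac P wP (+ (↧ₙ f)) ⌋)) × k ≡ s * ↧ₙ f

  gcd-boundedMultiple : ∀ {c k wa wP} .{{_ : NonZero c}} .{{_ : NonZero k}} →
    + c ℤ.≤ wa → + k ℤ.≤ wP → BoundedMultipleOfDenominator wa wP (+ c ℚ./ k) k
  gcd-boundedMultiple {c} {k} {wa} {wP} c≤wa k≤wP =
    g , ℕ.>-nonZero⁻¹ g , ℤP.⊓-glb numerator-bound denominator-bound , sym g*↧f≡k
    where
    f : ℚ
    f = + c ℚ./ k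
    g : ℕ
    g = gcd c k
    open GcdNonZero c k
    instance
      c/g≢0 : NonZero (c / g)
      c/g≢0 = ℕ.≢-nonZero (m/gcd[m,n]≢0 c k)
    g*↧f≡k : g * ↧ₙ f ≡ k
    g*↧f≡k = trans (cong (g *_) (↧ₙ-+/ c k)) (m*[n/m]≡n (gcd[m,n]∣n c k))
    numerator-bound : + g ℤ.≤ ⌊ frac P wa (↥ f) ⌋
    numerator-bound = subst (λ d → + g ℤ.≤ ⌊ frac P wa d ⌋) (sym (↥-+/ c k))
      (≤-floor-frac (subst (λ c′ → + c′ ℤ.≤ wa) (sym (m*[n/m]≡n (gcd[m,n]∣m c k))) c≤wa))
    denominator-bound : + g ℤ.≤ ⌊ frac P wP (+ ↧ₙ f) ⌋
    denominator-bound = ≤-floor-frac (subst (λ k′ → + k′ ℤ.≤ wP) (sym g*↧f≡k) k≤wP)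

  proper-frac-boundedMultiple : ∀ {x y k wa wP} →
    + 0 ℤ.< x → x ℤ.< y → y ≡ + k → x ℤ.≤ wa → + k ℤ.≤ wP →
    frac P x y ℚ.< 1ℚ × BoundedMultipleOfDenominator wa wP (frac P x y) k
  proper-frac-boundedMultiple {+ zero} (+<+ ()) _ _ _ _
  proper-frac-boundedMultiple {+[1+ c ]} {_} {suc k} _ (+<+ c<k) refl c≤wa k≤wP =
    +/<1 c<k , gcd-boundedMultiple c≤wa k≤wP

  module _ (ω : Subset n → ℤ) where

    ratio∈𝓕 : ∀ a {b} → b ≢ 0̂ → ratio P ω b a List.∈ 𝓕 P ω a
    ratio∈𝓕 _ b≢0̂ = there (there (∈-map⁺ _ (∈-filter⁺ (λ b′ → ¬? (b′ Fin.≟ 0̂)) (∈-allFin _) b≢0̂)))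

    𝔣≤ : ∀ a {r} → 0ℚ ℚ.≤ r → 𝔣 P ω a r ℚ.≤ r
    𝔣≤ a {r} 0≤r = foldr-preservesᵇ ℚP.⊔-lub 0≤r (all-filter (ℚP._≤? r) (𝓕 P ω a))

    ω-∧Δ-bounds : Admissible P ω → ∀ {A′ A″} → IsAntichain P A′ → IsAntichain P A″ →
      InIdeal P A′ 0̂ → InIdeal P A″ 0̂ → ⁅ 0̂ ⁆ ≢ _∧Δ_ P A′ A″ →
      + 0 ℤ.< ω (_∧Δ_ P A′ A″) × ω (_∧Δ_ P A′ A″) ℤ.≤ ω A′ × ω (_∧Δ_ P A′ A″) ℤ.≤ ω A″
    ω-∧Δ-bounds (_ , _ , monotone) {A′} {A″} anti′ anti″ 0̂∈𝔍A′ 0̂∈𝔍A″ ⁅0̂⁆≢m =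
      proj₁ below-A′ , proj₂ below-A′ , proj₂ (monotone _ _ maxOf-antichain anti″ ⁅0̂⁆⊏m (∧Δ-⊑ʳ A′ A″))
      where
      ⁅0̂⁆⊏m = ⁅⁆-⊑ (from InIdeal-∧Δ (0̂∈𝔍A′ , 0̂∈𝔍A″)) , ⁅0̂⁆≢m
      below-A′ = monotone _ _ maxOf-antichain anti′ ⁅0̂⁆⊏m (∧Δ-⊑ˡ A′ A″)

    InI⇒InD : Admissible P ω → (∀ a′ a″ → ω (_∧Δ_ P ⁅ a′ ⁆ ⁅ a″ ⁆) ≡ ω ⁅ a′ ⁆ → a′ ≤ a″) →
      ∀ {r A k b} → 0ℚ ℚ.≤ r → + k ℤ.≤ ωP P ω → InI P ω r A k b → InD P ω r A k
    InI⇒InD adm@(_ , ω⁅0̂⁆≡0 , _) meet≡⇒≤ {r} {A} {k} {b} 0≤r k≤ωP (b≢0̂ , ωb≡k , r<ratio) a a∈A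
      with b ≤? a
    ... | yes b≤a = inj₂ (b , b≤a , b≢0̂ , ωb≡k)
    ... | no  b≰a =
      let (0<ωm , ωm≤ωb , ωm≤ωa) = ω-∧Δ-bounds adm (⁅⁆-antichain b) (⁅⁆-antichain a)
                                     (from InIdeal-⁅⁆ (0̂-least b)) (from InIdeal-⁅⁆ (0̂-least a)) ⁅0̂⁆≢m
          ωm<ωb = ℤP.≤∧≢⇒< ωm≤ωb (b≰a ∘ meet≡⇒≤ b a)
          (f<1 , k∈multiples) = proper-frac-boundedMultiple 0<ωm ωm<ωb ωb≡k ωm≤ωa k≤ωP
      in inj₁ (ratio P ω b a , ratio∈𝓕 a b≢0̂ , ℚP.≤-<-trans (𝔣≤ a 0≤r) (r<ratio a a∈A) ,
               f<1 , k∈multiples)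
      where
      ⁅0̂⁆≢m : ⁅ 0̂ ⁆ ≢ _∧Δ_ P ⁅ b ⁆ ⁅ a ⁆
      ⁅0̂⁆≢m ⁅0̂⁆≡m = ℚP.<-irrefl refl (ℚP.≤-<-trans 0≤r (subst (r ℚ.<_) ratio≡0 (r<ratio a a∈A)))
        where
        ratio≡0 : ratio P ω b a ≡ 0ℚ
        ratio≡0 = trans (cong (λ x → frac P x (ω₁ P ω b)) (trans (cong ω (sym ⁅0̂⁆≡m)) ω⁅0̂⁆≡0))
                        (frac-0 (ω₁ P ω b))

proposition8p2 : (P : FinBoundedPoset) → let open FinBoundedPoset P in
    1 ℕ.< n →
    (ω : Subset n → ℤ.ℤ) → Admissible P ω →
    (∀ a' a'' → (ω (_∧Δ_ P ⁅ a' ⁆ ⁅ a'' ⁆) ≡ ω ⁅ a' ⁆) ⇔ (a' ≤ a'')) →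
    (r : ℚ) → 0ℚ ℚ.≤ r → r ℚ.< 1ℚ →
    (A : Subset n) → IsAntichain P A → A ≢ Sub.⊥ → A ≢ ⁅ 0̂ ⁆ →
    (k : ℕ) → 1 ℕ.≤ k → + k ℤ.≤ ωP P ω →
    (∀ p → (∀ a → a ∈ A → p ≤ a) → p ≡ 0̂) →
    ¬ InD P ω r A k →
    ∀ b → ¬ InI P ω r A k b
-- Of the meet condition only the implication ω({a'} ∧ {a''}) = ω(a') ⇒ a' ≤ a'' is used;
-- |P| > 1, r < 1, the conditions on A, 1 ≤ k and the trivial intersection of ideals are not.
proposition8p2 P _ ω adm meet≡⇔≤ r 0≤r _ A _ _ _ k _ k≤ωP _ k∉D b b∈I =
  k∉D (InI⇒InD P ω adm (λ a′ a″ → to (meet≡⇔≤ a′ a″)) 0≤r k≤ωP b∈I)
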